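{- Let $G=(V,E)$ be a graph with $k$ vertices and let $d=k+|E|+1$. Then there exists a double covering polytope $Q\subset\mathbb R^d$ such that $\mathrm{SSP}(G)\le_A Q$.
   Context: For a graph $G=(V,E)$ with $V=\{v_1,\dots,v_k\}$, the stable set polytope $\mathrm{SSP}(G)$ is the convex hull of $\{y\in\{0,1\}^k : y_i+y_j\le 1 \text{ for every edge }\{v_i,v_j\}\in E\}$. A double covering polytope in $\mathbb R^d$ is a polytope of the form $\mathrm{conv}\{x\in\{0,1\}^d : Bx=\mathbf 2\}$, where $B$ is an $m\times d$ matrix with entries in $\{0,1\}$, each row of $B$ contains exactly four $1$'s, and $\mathbf 2$ is the all-$2$ vector of length $m$. For polytopes $p,q$, $p\le_A q$ means that $p$ is affinely equivalent (there is an affine bijection between their affine hulls mapping one onto the other) to $q$ or to a face of $q$.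
   Formalization: The polytopes $\mathrm{SSP}(G)$ and $Q$, the affine bijection and the inequality cutting out the face of $Q$ are taken over ℚ rather than ℝ. -}

module Defs where

open import Data.Nat using (ℕ; zero; suc)
open import Data.Fin using (Fin; _<_)
open import Data.Bool using (Bool; true; false; if_then_else_)
open import Data.Product using (Σ; ∃; ∃-syntax; _×_; _,_)
open import Data.Sum using (_⊎_)
open import Data.List using (List; []; _∷_; length; foldr)
open import Data.List.Relation.Unary.All using (All)
open import Data.List.Relation.Unary.Unique.Propositional using (Unique)
open import Data.Rational using (ℚ; 0ℚ; 1ℚ; _+_; _*_; _≤_)
open import Relation.Binary.PropositionalEquality using (_≡_)

Pt : ℕ → Set
Pt n = Fin n → ℚ

PSet : ℕ → Set₁
PSet n = Pt n → Set

_≈ₚ_ : ∀ {n} → Pt n → Pt n → Set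
x ≈ₚ y = ∀ i → x i ≡ y i

two : ℚ
two = 1ℚ + 1ℚ

Σᶠ : ∀ n → (Fin n → ℚ) → ℚ
Σᶠ zero f = 0ℚ
Σᶠ (suc n) f = f Data.Fin.zero + Σᶠ n (λ i → f (Data.Fin.suc i))

dot : ∀ {n} → Pt n → Pt n → ℚ
dot {n} c x = Σᶠ n (λ i → c i * x i)

countTrue : ∀ n → (Fin n → Bool) → ℕ
countTrue zero r = zero
countTrue (suc n) r =
  (if r Data.Fin.zero then suc else (λ m → m)) (countTrue n (λ i → r (Data.Fin.suc i)))

IsBinary : ∀ {n} → Pt n → Set
IsBinary x = ∀ i → (x i ≡ 0ℚ) ⊎ (x i ≡ 1ℚ)

weightSum : ∀ {n} → List (ℚ × Pt n) → ℚ
weightSum = foldr (λ { (a , _) acc → a + acc }) 0ℚ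

combo : ∀ {n} → List (ℚ × Pt n) → Pt n
combo l i = foldr (λ { (a , p) acc → a * p i + acc }) 0ℚ l

conv : ∀ {n} → PSet n → PSet n
conv {n} S x = ∃[ l ] (All (λ { (a , p) → (0ℚ ≤ a) × S p }) l
                      × weightSum l ≡ 1ℚ × combo l ≈ₚ x)

aff : ∀ {n} → PSet n → PSet n
aff {n} S x = ∃[ l ] (All (λ { (_ , p) → S p }) l
                     × weightSum l ≡ 1ℚ × combo l ≈ₚ x)

record Graph (k : ℕ) : Set where
  field
    edges   : List (Fin k × Fin k)
    ordered : All (λ { (i , j) → i < j }) edges
    unique  : Unique edges
open Graph public

StableVec : ∀ {k} → Graph k → PSet k
StableVec G y = IsBinary y × All (λ { (i , j) → y i + y j ≤ 1ℚ }) (edges G)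

SSP : ∀ {k} → Graph k → PSet k
SSP G = conv (StableVec G)

Matrix01 : ℕ → ℕ → Set
Matrix01 m d = Fin m → Fin d → Bool

FourPerRow : ∀ {m d} → Matrix01 m d → Set
FourPerRow {m} {d} B = ∀ r → countTrue d (B r) ≡ 4

rowTimes : ∀ {d} → (Fin d → Bool) → Pt d → ℚ
rowTimes {d} row x = Σᶠ d (λ j → if row j then x j else 0ℚ)

DCP : ∀ {m d} → Matrix01 m d → PSet d
DCP {m} {d} B = conv (λ x → IsBinary x × (∀ r → rowTimes (B r) x ≡ two))

record AffineMap (k d : ℕ) : Set where
  field
    A : Fin d → Fin k → ℚ
    b : Pt d
open AffineMap public

apply : ∀ {k d} → AffineMap k d → Pt k → Pt d
apply f x i = dot (A f i) x + b f i

-- p and F are affinely equivalent: an affine map, injective on aff(p),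
-- mapping p onto F (hence restricting to an affine bijection aff(p) → aff(F)).
AffEquiv : ∀ {k d} → PSet k → PSet d → Set
AffEquiv {k} {d} p F = ∃[ f ]
  ( (∀ x → p x → F (apply f x))
  × (∀ y → F y → ∃[ x ] (p x × apply f x ≈ₚ y))
  × (∀ x y → aff p x → aff p y → apply f x ≈ₚ apply f y → x ≈ₚ y) )

-- faces of q: q ∩ {c·x = δ} for a valid inequality c·x ≤ δ (c = 0, δ = 0 gives q)
Face : ∀ {d} → PSet d → (c : Pt d) → ℚ → PSet d
Face q c δ x = q x × dot c x ≡ δ

ValidIneq : ∀ {d} → PSet d → Pt d → ℚ → Set
ValidIneq q c δ = ∀ x → q x → dot c x ≤ δ

_≤A_ : ∀ {k d} → PSet k → PSet d → Set
_≤A_ {k} {d} p q = ∃[ c ] ∃[ δ ] (ValidIneq q c δ × AffEquiv p (Face q c δ))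

-- Index the coordinates of ℚ^(k + |E| + 1) by the vertices, the edges and one extra coordinate w,
-- and let the row of B for the edge e = {u, v} read x_u + x_v + z_e + w = 2.  The affine map
-- x ↦ (x, 1 - x_u - x_v, 1) sends the stable set vectors of G bijectively onto the 0/1 solutions
-- with w = 1, and the projection onto the vertex coordinates inverts it there.  Since w ≤ 1 is
-- valid and the face w = 1 of a 0/1 hull is the hull of the 0/1 points on it, both maps pass to
-- convex hulls: SSP(G) is affinely equivalent to the face w = 1 of the double covering polytope.

module Submission where

open import Defs
open import Data.Nat as ℕ using (ℕ; zero; suc; s≤s)
open import Data.Fin as Fin using (Fin; toℕ; _↑ˡ_; _↑ʳ_; splitAt)
open import Data.Fin.Properties using (splitAt-↑ˡ; splitAt-↑ʳ; join-splitAt)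
open import Data.Bool using (Bool; true; false; if_then_else_; _∨_)
open import Data.Sum using (_⊎_; inj₁; inj₂; [_,_]′)
open import Data.Product using (∃-syntax; _×_; _,_; proj₁; proj₂; map₂)
open import Data.List using (List; []; _∷_; length; map; lookup)
open import Data.List.Relation.Unary.All as All using (All; []; _∷_)
open import Data.List.Relation.Unary.All.Properties using (map⁺)
open import Data.List.Relation.Unary.Any using (index)
open import Data.List.Relation.Unary.Any.Properties using (lookup-index)
open import Data.List.Membership.Propositional using (_∈_)
open import Data.List.Membership.Propositional.Properties using (∈-lookup)
open import Data.Rational
  using (ℚ; 0ℚ; 1ℚ; -_; _+_; _*_; _-_; _≤_; _≤?_; 1/_; ≢-nonZero; nonNegative)
open import Data.Rational.Properties
  using ( ≤-refl; ≤-trans; ≤-reflexive; ≤-antisym; ≮⇒≥; <-irrefl; +-mono-≤; +-mono-<-≤; +-mono-≤-<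
        ; *-monoˡ-≤-nonNeg; nonNegative⁻¹; +-comm; +-assoc; +-identityˡ; +-identityʳ
        ; *-zeroˡ; *-zeroʳ; *-identityˡ; *-identityʳ; *-assoc; *-inverseˡ; *-distribˡ-+; _≟_ )
open import Data.Rational.Solver using (module +-*-Solver)
open import Function using (_∘_)
open import Relation.Binary.PropositionalEquality
open import Relation.Nullary using (yes; no)
open import Relation.Nullary.Decidable using (toWitnessFalse)
open import Data.Empty using (⊥-elim)

open +-*-Solver

Bit : ℚ → Set
Bit a = a ≡ 0ℚ ⊎ a ≡ 1ℚ

bit-≤-1 : ∀ {a} → Bit a → a ≤ 1ℚ
bit-≤-1 (inj₁ refl) = nonNegative⁻¹ 1ℚ
bit-≤-1 (inj₂ refl) = ≤-refl

complement-≤-1 : ∀ {a} → Bit a → 1ℚ - a ≤ 1ℚ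
complement-≤-1 (inj₁ refl) = ≤-refl
complement-≤-1 (inj₂ refl) = nonNegative⁻¹ 1ℚ

complement-bit : ∀ {a b} → Bit a → Bit b → a + b ≤ 1ℚ → Bit (1ℚ - (a + b))
complement-bit (inj₁ refl) (inj₁ refl) _   = inj₂ refl
complement-bit (inj₁ refl) (inj₂ refl) _   = inj₁ refl
complement-bit (inj₂ refl) (inj₁ refl) _   = inj₁ refl
complement-bit (inj₂ refl) (inj₂ refl) 2≤1 = ⊥-elim (toWitnessFalse {a? = two ≤? 1ℚ} _ 2≤1)

complement-unique : ∀ s c → (s + c) + 1ℚ ≡ two → 1ℚ - s ≡ c
complement-unique s c sum≡2 = begin
  1ℚ - s                          ≡⟨ solve 2 (λ s o → o :- s := ((o :+ o) :- s) :- o) refl s 1ℚ ⟩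
  (two - s) - 1ℚ                  ≡⟨ cong (λ t → (t - s) - 1ℚ) (sym sum≡2) ⟩
  (((s + c) + 1ℚ) - s) - 1ℚ       ≡⟨ solve 3 (λ s c o → (((s :+ c) :+ o) :- s) :- o := c) refl s c 1ℚ ⟩
  c                               ∎
  where open ≡-Reasoning

+-tight : ∀ {x x′ y y′ : ℚ} → x ≤ x′ → y ≤ y′ → x + y ≡ x′ + y′ → x ≡ x′ × y ≡ y′
+-tight x≤x′ y≤y′ sum≡ =
  ≤-antisym x≤x′ (≮⇒≥ (λ x<x′ → <-irrefl sum≡ (+-mono-<-≤ x<x′ y≤y′))) ,
  ≤-antisym y≤y′ (≮⇒≥ (λ y<y′ → <-irrefl sum≡ (+-mono-≤-< x≤x′ y<y′)))

*-cancelˡ-≡ : ∀ {a x y : ℚ} → a ≢ 0ℚ → a * x ≡ a * y → x ≡ y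
*-cancelˡ-≡ {a} {x} {y} a≢0 ax≡ay = begin
  x                ≡⟨ sym (*-identityˡ x) ⟩
  1ℚ * x           ≡⟨ cong (_* x) (sym (*-inverseˡ a)) ⟩
  (1/ a * a) * x   ≡⟨ *-assoc (1/ a) a x ⟩
  1/ a * (a * x)   ≡⟨ cong (1/ a *_) ax≡ay ⟩
  1/ a * (a * y)   ≡⟨ sym (*-assoc (1/ a) a y) ⟩
  (1/ a * a) * y   ≡⟨ cong (_* y) (*-inverseˡ a) ⟩
  1ℚ * y           ≡⟨ *-identityˡ y ⟩
  y                ∎
  where
  open ≡-Reasoning
  instance
    a-nonZero = ≢-nonZero a≢0

Σᶠ-cong : ∀ n {f g : Fin n → ℚ} → (∀ i → f i ≡ g i) → Σᶠ n f ≡ Σᶠ n g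
Σᶠ-cong zero    f≗g = refl
Σᶠ-cong (suc n) f≗g = cong₂ _+_ (f≗g Fin.zero) (Σᶠ-cong n (f≗g ∘ Fin.suc))

Σᶠ-0 : ∀ n → Σᶠ n (λ _ → 0ℚ) ≡ 0ℚ
Σᶠ-0 zero    = refl
Σᶠ-0 (suc n) = trans (+-identityˡ _) (Σᶠ-0 n)

Σᶠ-+ : ∀ n (f g : Fin n → ℚ) → Σᶠ n (λ i → f i + g i) ≡ Σᶠ n f + Σᶠ n g
Σᶠ-+ zero    f g = refl
Σᶠ-+ (suc n) f g rewrite Σᶠ-+ n (f ∘ Fin.suc) (g ∘ Fin.suc) =
  solve 4 (λ a b c d → (a :+ b) :+ (c :+ d) := (a :+ c) :+ (b :+ d)) refl
    (f Fin.zero) (g Fin.zero) (Σᶠ n (f ∘ Fin.suc)) (Σᶠ n (g ∘ Fin.suc))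

Σᶠ-*ˡ : ∀ n a (f : Fin n → ℚ) → Σᶠ n (λ i → a * f i) ≡ a * Σᶠ n f
Σᶠ-*ˡ zero    a f = sym (*-zeroʳ a)
Σᶠ-*ˡ (suc n) a f =
  trans (cong (a * f Fin.zero +_) (Σᶠ-*ˡ n a (f ∘ Fin.suc))) (sym (*-distribˡ-+ a _ _))

Σᶠ-↑ : ∀ m n (f : Fin (m ℕ.+ n) → ℚ) →
       Σᶠ (m ℕ.+ n) f ≡ Σᶠ m (f ∘ (_↑ˡ n)) + Σᶠ n (f ∘ (m ↑ʳ_))
Σᶠ-↑ zero    n f = sym (+-identityˡ _)
Σᶠ-↑ (suc m) n f =
  trans (cong (f Fin.zero +_) (Σᶠ-↑ m n (f ∘ Fin.suc)))
        (sym (+-assoc (f Fin.zero) (Σᶠ m (f ∘ Fin.suc ∘ (_↑ˡ n))) (Σᶠ n (f ∘ Fin.suc ∘ (m ↑ʳ_)))))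

countTrue-cong : ∀ n {r s : Fin n → Bool} → (∀ i → r i ≡ s i) → countTrue n r ≡ countTrue n s
countTrue-cong zero    r≗s = refl
countTrue-cong (suc n) {r} {s} r≗s
  rewrite r≗s Fin.zero | countTrue-cong n {r ∘ Fin.suc} {s ∘ Fin.suc} (r≗s ∘ Fin.suc) = refl

countTrue-↑ : ∀ m n (r : Fin (m ℕ.+ n) → Bool) →
              countTrue (m ℕ.+ n) r ≡ countTrue m (r ∘ (_↑ˡ n)) ℕ.+ countTrue n (r ∘ (m ↑ʳ_))
countTrue-↑ zero    n r = refl
countTrue-↑ (suc m) n r with r Fin.zero
... | true  = cong suc (countTrue-↑ m n (r ∘ Fin.suc))
... | false = countTrue-↑ m n (r ∘ Fin.suc)

_≡ᵇ_ : ∀ {n} → Fin n → Fin n → Bool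
i ≡ᵇ j = toℕ i ℕ.≡ᵇ toℕ j

countTrue-none : ∀ n → countTrue n (λ _ → false) ≡ 0
countTrue-none zero    = refl
countTrue-none (suc n) = countTrue-none n

countTrue-single : ∀ n (j : Fin n) → countTrue n (j ≡ᵇ_) ≡ 1
countTrue-single (suc n) Fin.zero    = cong suc (countTrue-none n)
countTrue-single (suc n) (Fin.suc j) = countTrue-single n j

countTrue-pair : ∀ n {u v : Fin n} → u Fin.< v → countTrue n (λ i → u ≡ᵇ i ∨ v ≡ᵇ i) ≡ 2
countTrue-pair (suc n) {Fin.zero}  {Fin.suc v} _         = cong suc (countTrue-single n v)
countTrue-pair (suc n) {Fin.suc u} {Fin.suc v} (s≤s u<v) = countTrue-pair n u<v

rowTimes-single : ∀ {n} (j : Fin n) (x : Pt n) → rowTimes (j ≡ᵇ_) x ≡ x j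
rowTimes-single {suc n} Fin.zero    x = trans (cong (x Fin.zero +_) (Σᶠ-0 n)) (+-identityʳ _)
rowTimes-single {suc n} (Fin.suc j) x = trans (+-identityˡ _) (rowTimes-single j (x ∘ Fin.suc))

rowTimes-pair : ∀ {n} {u v : Fin n} → u Fin.< v → (x : Pt n) →
                rowTimes (λ i → u ≡ᵇ i ∨ v ≡ᵇ i) x ≡ x u + x v
rowTimes-pair {suc n} {Fin.zero}  {Fin.suc v} _         x = cong (x Fin.zero +_) (rowTimes-single v (x ∘ Fin.suc))
rowTimes-pair {suc n} {Fin.suc u} {Fin.suc v} (s≤s u<v) x = trans (+-identityˡ _) (rowTimes-pair u<v (x ∘ Fin.suc))

indicator : ∀ {n} → (Fin n → Bool) → Pt n
indicator r i = if r i then 1ℚ else 0ℚ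

dot-indicator : ∀ {n} (r : Fin n → Bool) (x : Pt n) → dot (indicator r) x ≡ rowTimes r x
dot-indicator {n} r x = Σᶠ-cong n select
  where
  select : ∀ i → indicator r i * x i ≡ (if r i then x i else 0ℚ)
  select i with r i
  ... | true  = *-identityˡ (x i)
  ... | false = *-zeroˡ (x i)

dot-neg : ∀ {n} (c x : Pt n) → dot (λ i → - c i) x ≡ - dot c x
dot-neg {n} c x = begin
  Σᶠ n (λ i → - c i * x i)          ≡⟨ Σᶠ-cong n (λ i → solve 2 (λ c x → (:- c) :* x := (:- con 1ℚ) :* (c :* x)) refl (c i) (x i)) ⟩
  Σᶠ n (λ i → - 1ℚ * (c i * x i))   ≡⟨ Σᶠ-*ˡ n (- 1ℚ) _ ⟩
  - 1ℚ * dot c x                    ≡⟨ solve 1 (λ s → (:- con 1ℚ) :* s := :- s) refl (dot c x) ⟩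
  - dot c x                         ∎
  where open ≡-Reasoning

dot-zeroˡ : ∀ {n} (x : Pt n) → dot (λ _ → 0ℚ) x ≡ 0ℚ
dot-zeroˡ {n} x = trans (Σᶠ-cong n (λ i → *-zeroˡ (x i))) (Σᶠ-0 n)

dot-congʳ : ∀ {n} (c : Pt n) {x y : Pt n} → x ≈ₚ y → dot c x ≡ dot c y
dot-congʳ {n} c x≈y = Σᶠ-cong n (λ i → cong (c i *_) (x≈y i))

apply-cong : ∀ {k d} (f : AffineMap k d) {x y : Pt k} → x ≈ₚ y → apply f x ≈ₚ apply f y
apply-cong f x≈y i = cong (_+ b f i) (dot-congʳ (A f i) x≈y)

wsum : ∀ {n} → List (ℚ × Pt n) → (Pt n → ℚ) → ℚ
wsum []            g = 0ℚ
wsum ((a , p) ∷ l) g = a * g p + wsum l g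

combo≡wsum : ∀ {n} (l : List (ℚ × Pt n)) i → combo l i ≡ wsum l (λ p → p i)
combo≡wsum []            i = refl
combo≡wsum ((a , p) ∷ l) i = cong (a * p i +_) (combo≡wsum l i)

wsum-+ : ∀ {n} (l : List (ℚ × Pt n)) (g h : Pt n → ℚ) →
         wsum l (λ p → g p + h p) ≡ wsum l g + wsum l h
wsum-+ []            g h = refl
wsum-+ ((a , p) ∷ l) g h rewrite wsum-+ l g h =
  solve 5 (λ a x y u v → a :* (x :+ y) :+ (u :+ v) := (a :* x :+ u) :+ (a :* y :+ v)) refl
    a (g p) (h p) (wsum l g) (wsum l h)

wsum-const : ∀ {n} (l : List (ℚ × Pt n)) t → wsum l (λ _ → t) ≡ t * weightSum l
wsum-const []            t = sym (*-zeroʳ t)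
wsum-const ((a , p) ∷ l) t rewrite wsum-const l t =
  solve 3 (λ a t w → a :* t :+ t :* w := t :* (a :+ w)) refl a t (weightSum l)

wsum-cong : ∀ {n} (l : List (ℚ × Pt n)) {g h : Pt n → ℚ} →
            All (λ ap → g (proj₂ ap) ≡ h (proj₂ ap)) l → wsum l g ≡ wsum l h
wsum-cong []            []           = refl
wsum-cong ((a , p) ∷ l) (gp≡hp ∷ eq) = cong₂ _+_ (cong (a *_) gp≡hp) (wsum-cong l eq)

wsum-map : ∀ {n m} (F : Pt n → Pt m) (l : List (ℚ × Pt n)) (g : Pt m → ℚ) →
           wsum (map (map₂ F) l) g ≡ wsum l (g ∘ F)
wsum-map F []            g = refl
wsum-map F ((a , p) ∷ l) g = cong (a * g (F p) +_) (wsum-map F l g)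

weightSum-map : ∀ {n m} (F : Pt n → Pt m) (l : List (ℚ × Pt n)) →
                weightSum (map (map₂ F) l) ≡ weightSum l
weightSum-map F []            = refl
weightSum-map F ((a , p) ∷ l) = cong (a +_) (weightSum-map F l)

combo-map : ∀ {n m} (F : Pt n → Pt m) (l : List (ℚ × Pt n)) i →
            combo (map (map₂ F) l) i ≡ wsum l (λ p → F p i)
combo-map F l i = trans (combo≡wsum (map (map₂ F) l) i) (wsum-map F l (λ q → q i))

wsum-≤ : ∀ {n} (l : List (ℚ × Pt n)) (g : Pt n → ℚ) (δ : ℚ) →
         All (λ ap → 0ℚ ≤ proj₁ ap × g (proj₂ ap) ≤ δ) l → wsum l g ≤ δ * weightSum l
wsum-≤ []            g δ []                     = ≤-reflexive (sym (*-zeroʳ δ))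
wsum-≤ ((a , p) ∷ l) g δ ((0≤a , gp≤δ) ∷ bounds) =
  ≤-trans (+-mono-≤ (*-monoˡ-≤-nonNeg a {{nonNegative 0≤a}} gp≤δ) (wsum-≤ l g δ bounds))
          (≤-reflexive (solve 3 (λ a δ w → a :* δ :+ δ :* w := δ :* (a :+ w)) refl a δ (weightSum l)))

wsum-tight : ∀ {n} (l : List (ℚ × Pt n)) (g : Pt n → ℚ) (δ : ℚ) →
             All (λ ap → 0ℚ ≤ proj₁ ap × g (proj₂ ap) ≤ δ) l → wsum l g ≡ δ * weightSum l →
             All (λ ap → proj₁ ap * g (proj₂ ap) ≡ proj₁ ap * δ) l
wsum-tight []            g δ []                     _    = []
wsum-tight ((a , p) ∷ l) g δ ((0≤a , gp≤δ) ∷ bounds) sum≡ =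
  proj₁ tight ∷ wsum-tight l g δ bounds (proj₂ tight)
  where
  tight = +-tight (*-monoˡ-≤-nonNeg a {{nonNegative 0≤a}} gp≤δ) (wsum-≤ l g δ bounds)
            (trans sum≡ (solve 3 (λ a δ w → δ :* (a :+ w) := a :* δ :+ δ :* w) refl a δ (weightSum l)))

drop-zero-weights : ∀ {n} {P : ℚ × Pt n → Set} (l : List (ℚ × Pt n)) →
                    All (λ ap → proj₁ ap ≢ 0ℚ → P ap) l →
                    ∃[ l′ ] (All P l′ × weightSum l′ ≡ weightSum l × combo l′ ≈ₚ combo l)
drop-zero-weights []            []         = [] , [] , refl , λ _ → refl
drop-zero-weights ((a , p) ∷ l) (P-ap ∷ Ps) with drop-zero-weights l Ps | a ≟ 0ℚ
... | l′ , Pl′ , w≡ , c≈ | yes refl =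
  l′ , Pl′ , trans w≡ (sym (+-identityˡ _)) ,
  λ i → trans (c≈ i) (sym (trans (cong (_+ combo l i) (*-zeroˡ (p i))) (+-identityˡ _)))
... | l′ , Pl′ , w≡ , c≈ | no a≢0 =
  (a , p) ∷ l′ , P-ap a≢0 ∷ Pl′ , cong (a +_) w≡ , λ i → cong (a * p i +_) (c≈ i)

dot-combo : ∀ {n} (c : Pt n) (l : List (ℚ × Pt n)) → dot c (combo l) ≡ wsum l (dot c)
dot-combo {n} c []            = trans (Σᶠ-cong n (λ i → *-zeroʳ (c i))) (Σᶠ-0 n)
dot-combo {n} c ((a , p) ∷ l) = begin
  Σᶠ n (λ i → c i * (a * p i + combo l i))
    ≡⟨ Σᶠ-cong n (λ i → solve 4 (λ c a p r → c :* (a :* p :+ r) := a :* (c :* p) :+ c :* r) refl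
                          (c i) a (p i) (combo l i)) ⟩
  Σᶠ n (λ i → a * (c i * p i) + c i * combo l i)
    ≡⟨ Σᶠ-+ n _ _ ⟩
  Σᶠ n (λ i → a * (c i * p i)) + dot c (combo l)
    ≡⟨ cong₂ _+_ (Σᶠ-*ˡ n a _) (dot-combo c l) ⟩
  a * dot c p + wsum l (dot c) ∎
  where open ≡-Reasoning

apply-combo : ∀ {k d} (f : AffineMap k d) (l : List (ℚ × Pt k)) → weightSum l ≡ 1ℚ →
              apply f (combo l) ≈ₚ combo (map (map₂ (apply f)) l)
apply-combo f l w≡1 i = begin
  dot (A f i) (combo l) + b f i                 ≡⟨ cong₂ _+_ (dot-combo (A f i) l) b≡ ⟩
  wsum l (dot (A f i)) + wsum l (λ _ → b f i)   ≡⟨ sym (wsum-+ l _ _) ⟩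
  wsum l (λ p → apply f p i)                    ≡⟨ sym (combo-map (apply f) l i) ⟩
  combo (map (map₂ (apply f)) l) i              ∎
  where
  open ≡-Reasoning
  b≡ : b f i ≡ wsum l (λ _ → b f i)
  b≡ = sym (trans (wsum-const l (b f i)) (trans (cong (b f i *_) w≡1) (*-identityʳ _)))

conv-map : ∀ {k d} {S : PSet k} {T : PSet d} (f : AffineMap k d) →
           (∀ p → S p → T (apply f p)) → ∀ x → conv S x → conv T (apply f x)
conv-map f S⇒T x (l , l∈S , w≡1 , l≈x) =
  map (map₂ (apply f)) l ,
  map⁺ (All.map (λ { {_ , p} (0≤a , Sp) → 0≤a , S⇒T p Sp }) l∈S) ,
  trans (weightSum-map (apply f) l) w≡1 ,
  λ i → trans (sym (apply-combo f l w≡1 i)) (apply-cong f l≈x i)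

conv-fix : ∀ {k d} {S : PSet d} (f : AffineMap k d) (g : AffineMap d k) →
           (∀ p → S p → apply f (apply g p) ≈ₚ p) → ∀ y → conv S y → apply f (apply g y) ≈ₚ y
conv-fix f g fg≈id y (l , l∈S , w≡1 , l≈y) i = begin
  apply f (apply g y) i                  ≡⟨ sym (apply-cong f (apply-cong g l≈y) i) ⟩
  apply f (apply g (combo l)) i          ≡⟨ apply-cong f (apply-combo g l w≡1) i ⟩
  apply f (combo l′) i                   ≡⟨ apply-combo f l′ (trans (weightSum-map (apply g) l) w≡1) i ⟩
  combo (map (map₂ (apply f)) l′) i      ≡⟨ combo-map (apply f) l′ i ⟩
  wsum l′ (λ q → apply f q i)            ≡⟨ wsum-map (apply g) l _ ⟩
  wsum l (λ p → apply f (apply g p) i)   ≡⟨ wsum-cong l (All.map (λ { (_ , Sp) → fg≈id _ Sp i }) l∈S) ⟩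
  wsum l (λ p → p i)                     ≡⟨ sym (combo≡wsum l i) ⟩
  combo l i                              ≡⟨ l≈y i ⟩
  y i                                    ∎
  where
  open ≡-Reasoning
  l′ : List (ℚ × Pt _)
  l′ = map (map₂ (apply g)) l

conv-valid : ∀ {d} {S : PSet d} {c : Pt d} {δ : ℚ} → (∀ p → S p → dot c p ≤ δ) → ValidIneq (conv S) c δ
conv-valid {c = c} {δ} valid x (l , l∈S , w≡1 , l≈x) =
  ≤-trans (≤-reflexive (trans (sym (dot-congʳ c l≈x)) (dot-combo c l)))
    (≤-trans (wsum-≤ l (dot c) δ (All.map (λ { (0≤a , Sp) → 0≤a , valid _ Sp }) l∈S))
             (≤-reflexive (trans (cong (δ *_) w≡1) (*-identityʳ δ))))

face-conv : ∀ {d} {S : PSet d} {c : Pt d} {δ : ℚ} → (∀ p → S p → dot c p ≤ δ) →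
            ∀ x → Face (conv S) c δ x → conv (λ p → S p × dot c p ≡ δ) x
face-conv {S = S} {c} {δ} valid x ((l , l∈S , w≡1 , l≈x) , cx≡δ) =
  let l′ , Pl′ , w≡ , c≈ = drop-zero-weights l on-face
  in  l′ , Pl′ , trans w≡ w≡1 , λ i → trans (c≈ i) (l≈x i)
  where
  open ≡-Reasoning
  sum≡ : wsum l (dot c) ≡ δ * weightSum l
  sum≡ = begin
    wsum l (dot c)    ≡⟨ sym (dot-combo c l) ⟩
    dot c (combo l)   ≡⟨ dot-congʳ c l≈x ⟩
    dot c x           ≡⟨ cx≡δ ⟩
    δ                 ≡⟨ sym (*-identityʳ δ) ⟩
    δ * 1ℚ            ≡⟨ cong (δ *_) (sym w≡1) ⟩
    δ * weightSum l   ∎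
  tight : All (λ ap → proj₁ ap * dot c (proj₂ ap) ≡ proj₁ ap * δ) l
  tight = wsum-tight l (dot c) δ (All.map (λ { (0≤a , Sp) → 0≤a , valid _ Sp }) l∈S) sum≡
  on-face : All (λ ap → proj₁ ap ≢ 0ℚ → 0ℚ ≤ proj₁ ap × S (proj₂ ap) × dot c (proj₂ ap) ≡ δ) l
  on-face = All.zipWith (λ { ((0≤a , Sp) , ac≡aδ) a≢0 → 0≤a , Sp , *-cancelˡ-≡ a≢0 ac≡aδ }) (l∈S , tight)

module Coordinates (k n : ℕ) where

  vtx : Fin k → Fin (k ℕ.+ n ℕ.+ 1)
  vtx v = (v ↑ˡ n) ↑ˡ 1

  edg : Fin n → Fin (k ℕ.+ n ℕ.+ 1)
  edg e = (k ↑ʳ e) ↑ˡ 1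

  extra : Fin (k ℕ.+ n ℕ.+ 1)
  extra = (k ℕ.+ n) ↑ʳ Fin.zero

  coords : {X : Set} → (Fin k → X) → (Fin n → X) → X → Fin (k ℕ.+ n ℕ.+ 1) → X
  coords f g x i = [ [ f , g ]′ ∘ splitAt k , (λ _ → x) ]′ (splitAt (k ℕ.+ n) i)

  coords-vtx : ∀ {X : Set} (f : Fin k → X) g x v → coords f g x (vtx v) ≡ f v
  coords-vtx f g x v rewrite splitAt-↑ˡ (k ℕ.+ n) (v ↑ˡ n) 1 | splitAt-↑ˡ k v n = refl

  coords-edg : ∀ {X : Set} (f : Fin k → X) g x e → coords f g x (edg e) ≡ g e
  coords-edg f g x e rewrite splitAt-↑ˡ (k ℕ.+ n) (k ↑ʳ e) 1 | splitAt-↑ʳ k n e = refl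

  coords-extra : ∀ {X : Set} (f : Fin k → X) g x → coords f g x extra ≡ x
  coords-extra f g x rewrite splitAt-↑ʳ (k ℕ.+ n) 1 Fin.zero = refl

  coords-elim : (P : Fin (k ℕ.+ n ℕ.+ 1) → Set) →
                (∀ v → P (vtx v)) → (∀ e → P (edg e)) → P extra → ∀ i → P i
  coords-elim P P-vtx P-edg P-extra i with splitAt (k ℕ.+ n) i | join-splitAt (k ℕ.+ n) 1 i
  ... | inj₂ Fin.zero | refl = P-extra
  ... | inj₁ j        | refl with splitAt k j | join-splitAt k n j
  ...   | inj₁ v | refl = P-vtx v
  ...   | inj₂ e | refl = P-edg e

  countTrue-coords : ∀ f g → countTrue (k ℕ.+ n ℕ.+ 1) (coords f g true) ≡ countTrue k f ℕ.+ countTrue n g ℕ.+ 1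
  countTrue-coords f g = begin
    countTrue (k ℕ.+ n ℕ.+ 1) r
      ≡⟨ countTrue-↑ (k ℕ.+ n) 1 r ⟩
    countTrue (k ℕ.+ n) (r ∘ (_↑ˡ 1)) ℕ.+ countTrue 1 (λ _ → r extra)
      ≡⟨ cong₂ ℕ._+_ (countTrue-↑ k n (r ∘ (_↑ˡ 1))) (countTrue-cong 1 (λ _ → coords-extra f g true)) ⟩
    countTrue k (r ∘ vtx) ℕ.+ countTrue n (r ∘ edg) ℕ.+ 1
      ≡⟨ cong (ℕ._+ 1) (cong₂ ℕ._+_ (countTrue-cong k (coords-vtx f g true)) (countTrue-cong n (coords-edg f g true))) ⟩
    countTrue k f ℕ.+ countTrue n g ℕ.+ 1 ∎
    where
    open ≡-Reasoning
    r : Fin (k ℕ.+ n ℕ.+ 1) → Bool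
    r = coords f g true

  rowTimes-coords : ∀ f g (z : Pt (k ℕ.+ n ℕ.+ 1)) →
                    rowTimes (coords f g true) z ≡ (rowTimes f (z ∘ vtx) + rowTimes g (z ∘ edg)) + z extra
  rowTimes-coords f g z = begin
    Σᶠ (k ℕ.+ n ℕ.+ 1) F
      ≡⟨ Σᶠ-↑ (k ℕ.+ n) 1 F ⟩
    Σᶠ (k ℕ.+ n) (F ∘ (_↑ˡ 1)) + (F extra + 0ℚ)
      ≡⟨ cong₂ _+_ (Σᶠ-↑ k n (F ∘ (_↑ˡ 1))) (+-identityʳ (F extra)) ⟩
    (Σᶠ k (F ∘ vtx) + Σᶠ n (F ∘ edg)) + F extra
      ≡⟨ cong₂ _+_ (cong₂ _+_ (Σᶠ-cong k (λ v → cong (select (vtx v)) (coords-vtx f g true v)))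
                              (Σᶠ-cong n (λ e → cong (select (edg e)) (coords-edg f g true e))))
                   (cong (select extra) (coords-extra f g true)) ⟩
    (rowTimes f (z ∘ vtx) + rowTimes g (z ∘ edg)) + z extra ∎
    where
    open ≡-Reasoning
    select : Fin (k ℕ.+ n ℕ.+ 1) → Bool → ℚ
    select j s = if s then z j else 0ℚ
    F : Fin (k ℕ.+ n ℕ.+ 1) → ℚ
    F j = select j (coords f g true j)

module DoubleCover {k : ℕ} (G : Graph k) where

  n : ℕ
  n = length (edges G)

  open Coordinates k n public

  lo hi : Fin n → Fin k
  lo e = proj₁ (lookup (edges G) e)
  hi e = proj₂ (lookup (edges G) e)

  lo<hi : ∀ e → lo e Fin.< hi e
  lo<hi e = All.lookup (ordered G) (∈-lookup e)

  endpoints : Fin n → Fin k → Bool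
  endpoints e i = lo e ≡ᵇ i ∨ hi e ≡ᵇ i

  B : Matrix01 n (k ℕ.+ n ℕ.+ 1)
  B e = coords (endpoints e) (e ≡ᵇ_) true

  B-four : FourPerRow B
  B-four e = trans (countTrue-coords (endpoints e) (e ≡ᵇ_))
                   (cong₂ (λ s t → s ℕ.+ t ℕ.+ 1) (countTrue-pair k (lo<hi e)) (countTrue-single n e))

  rowTimes-B : ∀ e z → rowTimes (B e) z ≡ ((z (vtx (lo e)) + z (vtx (hi e))) + z (edg e)) + z extra
  rowTimes-B e z =
    trans (rowTimes-coords (endpoints e) (e ≡ᵇ_) z)
          (cong (_+ z extra) (cong₂ _+_ (rowTimes-pair (lo<hi e) (z ∘ vtx)) (rowTimes-single e (z ∘ edg))))

  DoubleCovering : PSet (k ℕ.+ n ℕ.+ 1)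
  DoubleCovering z = IsBinary z × (∀ r → rowTimes (B r) z ≡ two)

  unit-extra : Pt (k ℕ.+ n ℕ.+ 1)
  unit-extra = indicator (extra ≡ᵇ_)

  dot-unit-extra : ∀ z → dot unit-extra z ≡ z extra
  dot-unit-extra z = trans (dot-indicator (extra ≡ᵇ_) z) (rowTimes-single extra z)

  extra-≤-1 : ∀ z → DoubleCovering z → dot unit-extra z ≤ 1ℚ
  extra-≤-1 z (z-bin , _) = subst (_≤ 1ℚ) (sym (dot-unit-extra z)) (bit-≤-1 (z-bin extra))

  embed : AffineMap k (k ℕ.+ n ℕ.+ 1)
  embed = record
    { A = coords (λ v → indicator (v ≡ᵇ_)) (λ e i → - indicator (endpoints e) i) (λ _ → 0ℚ)
    ; b = coords (λ _ → 0ℚ) (λ _ → 1ℚ) 1ℚ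
    }

  embed-vtx : ∀ x v → apply embed x (vtx v) ≡ x v
  embed-vtx x v = begin
    dot (A embed (vtx v)) x + b embed (vtx v)   ≡⟨ cong₂ (λ a β → dot a x + β) (coords-vtx _ _ _ v) (coords-vtx _ _ _ v) ⟩
    dot (indicator (v ≡ᵇ_)) x + 0ℚ              ≡⟨ +-identityʳ _ ⟩
    dot (indicator (v ≡ᵇ_)) x                   ≡⟨ dot-indicator (v ≡ᵇ_) x ⟩
    rowTimes (v ≡ᵇ_) x                          ≡⟨ rowTimes-single v x ⟩
    x v                                         ∎
    where open ≡-Reasoning

  embed-edg : ∀ x e → apply embed x (edg e) ≡ 1ℚ - (x (lo e) + x (hi e))
  embed-edg x e = begin
    dot (A embed (edg e)) x + b embed (edg e)         ≡⟨ cong₂ (λ a β → dot a x + β) (coords-edg _ _ _ e) (coords-edg _ _ _ e) ⟩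
    dot (λ i → - indicator (endpoints e) i) x + 1ℚ    ≡⟨ cong (_+ 1ℚ) (dot-neg (indicator (endpoints e)) x) ⟩
    - dot (indicator (endpoints e)) x + 1ℚ            ≡⟨ cong (λ s → - s + 1ℚ) (dot-indicator (endpoints e) x) ⟩
    - rowTimes (endpoints e) x + 1ℚ                   ≡⟨ cong (λ s → - s + 1ℚ) (rowTimes-pair (lo<hi e) x) ⟩
    - (x (lo e) + x (hi e)) + 1ℚ                      ≡⟨ +-comm (- (x (lo e) + x (hi e))) 1ℚ ⟩
    1ℚ - (x (lo e) + x (hi e))                        ∎
    where open ≡-Reasoning

  embed-extra : ∀ x → apply embed x extra ≡ 1ℚ
  embed-extra x = begin
    dot (A embed extra) x + b embed extra   ≡⟨ cong₂ (λ a β → dot a x + β) (coords-extra _ _ _) (coords-extra _ _ _) ⟩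
    dot (λ _ → 0ℚ) x + 1ℚ                   ≡⟨ cong (_+ 1ℚ) (dot-zeroˡ x) ⟩
    0ℚ + 1ℚ                                 ≡⟨ +-identityˡ 1ℚ ⟩
    1ℚ                                      ∎
    where open ≡-Reasoning

  embed-stable : ∀ x → StableVec G x → DoubleCovering (apply embed x)
  embed-stable x (x-bin , x-stable) = binary , rows
    where
    binary : IsBinary (apply embed x)
    binary = coords-elim (Bit ∘ apply embed x)
      (λ v → subst Bit (sym (embed-vtx x v)) (x-bin v))
      (λ e → subst Bit (sym (embed-edg x e))
                   (complement-bit (x-bin (lo e)) (x-bin (hi e)) (All.lookup x-stable (∈-lookup e))))
      (subst Bit (sym (embed-extra x)) (inj₂ refl))
    rows : ∀ e → rowTimes (B e) (apply embed x) ≡ two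
    rows e = begin
      rowTimes (B e) (apply embed x)
        ≡⟨ rowTimes-B e (apply embed x) ⟩
      ((apply embed x (vtx (lo e)) + apply embed x (vtx (hi e))) + apply embed x (edg e)) + apply embed x extra
        ≡⟨ cong₂ _+_ (cong₂ _+_ (cong₂ _+_ (embed-vtx x (lo e)) (embed-vtx x (hi e))) (embed-edg x e)) (embed-extra x) ⟩
      ((x (lo e) + x (hi e)) + (1ℚ - (x (lo e) + x (hi e)))) + 1ℚ
        ≡⟨ solve 1 (λ s → (s :+ (con 1ℚ :- s)) :+ con 1ℚ := con 1ℚ :+ con 1ℚ) refl (x (lo e) + x (hi e)) ⟩
      two ∎
      where open ≡-Reasoning

  embed-injective : ∀ {x y} → apply embed x ≈ₚ apply embed y → x ≈ₚ y
  embed-injective {x} {y} ex≈ey v = trans (sym (embed-vtx x v)) (trans (ex≈ey (vtx v)) (embed-vtx y v))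

  project : AffineMap (k ℕ.+ n ℕ.+ 1) k
  project = record { A = λ v → indicator (vtx v ≡ᵇ_) ; b = λ _ → 0ℚ }

  project-apply : ∀ z v → apply project z v ≡ z (vtx v)
  project-apply z v = trans (+-identityʳ _) (trans (dot-indicator (vtx v ≡ᵇ_) z) (rowTimes-single (vtx v) z))

  tight-row : ∀ z → DoubleCovering z → dot unit-extra z ≡ 1ℚ →
              ∀ e → ((z (vtx (lo e)) + z (vtx (hi e))) + z (edg e)) + 1ℚ ≡ two
  tight-row z (_ , rows) cz≡1 e =
    trans (cong (((z (vtx (lo e)) + z (vtx (hi e))) + z (edg e)) +_) (trans (sym cz≡1) (dot-unit-extra z)))
          (trans (sym (rowTimes-B e z)) (rows e))

  project-stable : ∀ z → DoubleCovering z × dot unit-extra z ≡ 1ℚ → StableVec G (apply project z)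
  project-stable z (z-dc@(z-bin , _) , cz≡1) = binary , All.tabulate stable
    where
    binary : IsBinary (apply project z)
    binary v = subst Bit (sym (project-apply z v)) (z-bin (vtx v))
    edge-≤-1 : ∀ e → apply project z (lo e) + apply project z (hi e) ≤ 1ℚ
    edge-≤-1 e =
      subst₂ (λ s t → s + t ≤ 1ℚ) (sym (project-apply z (lo e))) (sym (project-apply z (hi e)))
        (subst (_≤ 1ℚ) (complement-unique (z (edg e)) endpoint-sum
                          (trans (cong (_+ 1ℚ) (+-comm (z (edg e)) endpoint-sum)) (tight-row z z-dc cz≡1 e)))
               (complement-≤-1 (z-bin (edg e))))
      where
      endpoint-sum : ℚ
      endpoint-sum = z (vtx (lo e)) + z (vtx (hi e))
    stable : ∀ {ij} → ij ∈ edges G → apply project z (proj₁ ij) + apply project z (proj₂ ij) ≤ 1ℚ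
    stable ij∈ = subst (λ ij → apply project z (proj₁ ij) + apply project z (proj₂ ij) ≤ 1ℚ)
                       (sym (lookup-index ij∈)) (edge-≤-1 (index ij∈))

  embed-project : ∀ z → DoubleCovering z × dot unit-extra z ≡ 1ℚ → apply embed (apply project z) ≈ₚ z
  embed-project z (z-dc , cz≡1) = coords-elim (λ i → apply embed x i ≡ z i)
    (λ v → trans (embed-vtx x v) (project-apply z v))
    (λ e → trans (embed-edg x e)
                 (trans (cong (λ s → 1ℚ - s) (cong₂ _+_ (project-apply z (lo e)) (project-apply z (hi e))))
                        (complement-unique (z (vtx (lo e)) + z (vtx (hi e))) (z (edg e)) (tight-row z z-dc cz≡1 e))))
    (trans (embed-extra x) (trans (sym cz≡1) (dot-unit-extra z)))
    where
    x : Pt k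
    x = apply project z

theorem5 : (k : ℕ) (G : Graph k) →
    ∃[ m ] ∃[ B ] (FourPerRow {m} {k ℕ.+ length (edges G) ℕ.+ 1} B × (SSP G ≤A DCP B))
theorem5 k G = n , B , B-four , unit-extra , 1ℚ , valid , embed , embed-face , project-face , injective
  where
  open DoubleCover G

  valid : ValidIneq (DCP B) unit-extra 1ℚ
  valid = conv-valid {c = unit-extra} extra-≤-1

  embed-face : ∀ x → SSP G x → Face (DCP B) unit-extra 1ℚ (apply embed x)
  embed-face x x∈SSP = conv-map embed embed-stable x x∈SSP , trans (dot-unit-extra _) (embed-extra x)

  project-face : ∀ y → Face (DCP B) unit-extra 1ℚ y → ∃[ x ] (SSP G x × apply embed x ≈ₚ y)
  project-face y y∈face =
    apply project y , conv-map project project-stable y tight , conv-fix embed project embed-project y tight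
    where
    tight = face-conv {c = unit-extra} extra-≤-1 y y∈face

  injective : ∀ x y → aff (SSP G) x → aff (SSP G) y → apply embed x ≈ₚ apply embed y → x ≈ₚ y
  injective _ _ _ _ = embed-injective
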